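{- Every X-tree has a $5$-track layout.
   Context: All graphs are finite, simple and undirected. A $t$-track assignment of a graph $G=(V,E)$ is a partition of $V$ into $t$ sets $V_1,\dots,V_t$ (tracks), each an independent set of $G$, together with a total order $<_i$ on each $V_i$. An X-crossing consists of two edges $(u,v)$ and $(x,y)$ with $u,x\in V_i$, $v,y\in V_j$ ($i\neq j$), $u<_i x$ and $y<_j v$. A $t$-track layout is a $t$-track assignment with no X-crossing. An X-tree is a complete binary tree (of some depth) together with extra edges: if $v_1,v_2,\dots,v_{2^d}$ are the vertices at level (depth) $d\ge 0$ of the tree in left-to-right order, then the edges $(v_i,v_{i+1})$ for $1\le i<2^d$ are added. -}

module Defs where

open import Data.Nat using (ℕ; zero; suc; _+_; _*_; _^_; _≤_; _<_)
open import Data.Fin using (Fin)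
open import Data.Product using (Σ; _×_; _,_; proj₁)
open import Data.Sum using (_⊎_; inj₁; inj₂)
open import Data.Empty using (⊥)
open import Relation.Binary.PropositionalEquality using (_≡_; _≢_)

record Graph : Set₁ where
  field
    V     : Set
    Adj   : V → V → Set
    sym   : ∀ {u v} → Adj u v → Adj v u
    irrefl : ∀ {u} → Adj u u → ⊥

-- A t-track layout.  The total order <_i on track V_i is given by a rank
-- function that is injective on each track: u <_i x  iff  rank u < rank x.
record TrackLayout (G : Graph) (t : ℕ) : Set where
  open Graph G
  field
    track : V → Fin t
    rank  : V → ℕ
    indep : ∀ u v → Adj u v → track u ≢ track v
    rank-inj : ∀ u v → track u ≡ track v → rank u ≡ rank v → u ≡ v
    noX : ∀ u v x y → Adj u v → Adj x y →
          track u ≡ track x → track v ≡ track y → track u ≢ track v →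
          rank u < rank x → rank y < rank v → ⊥

-- Vertices of the X-tree of depth d: pairs (ℓ , i) with level ℓ ≤ d and
-- position 0 ≤ i < 2^ℓ (left-to-right) on level ℓ.
XVertex : ℕ → Set
XVertex d = Σ (ℕ × ℕ) λ { (ℓ , i) → (ℓ ≤ d) × (i < 2 ^ ℓ) }

XEdge : (ℕ × ℕ) → (ℕ × ℕ) → Set
XEdge (ℓ , i) (ℓ' , j) =
  (ℓ' ≡ suc ℓ × (j ≡ 2 * i ⊎ j ≡ 2 * i + 1)) ⊎ (ℓ' ≡ ℓ × j ≡ suc i)

XAdj : ∀ {d} → XVertex d → XVertex d → Set
XAdj u v = XEdge (proj₁ u) (proj₁ v) ⊎ XEdge (proj₁ v) (proj₁ u)

private
  n≢1+n : ∀ n → n ≡ suc n → ⊥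
  n≢1+n (suc n) ()
  xedge-irrefl : ∀ p → XEdge p p → ⊥
  xedge-irrefl (ℓ , i) (inj₁ (e , _)) = n≢1+n ℓ e
  xedge-irrefl (ℓ , i) (inj₂ (_ , e)) = n≢1+n i e

XTree : ℕ → Graph
XTree d = record
  { V = XVertex d
  ; Adj = XAdj
  ; sym = λ { (inj₁ e) → inj₂ e ; (inj₂ e) → inj₁ e }
  ; irrefl = λ { {u} (inj₁ e) → xedge-irrefl (proj₁ u) e
               ; {u} (inj₂ e) → xedge-irrefl (proj₁ u) e }
  }

-- Give the vertex at depth l and position i the layer τ l i: the root is on layer 0 and a child
-- lies 1 or 2 layers below its parent, the choice being made so that horizontally adjacent
-- vertices are always exactly one layer apart.  Layers strictly increase along root-to-leaf
-- paths, so each layer is an antichain of the tree and its vertices cover pairwise disjoint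
-- intervals of leaves; ordering every layer by these intervals, no two edges between the same
-- two layers cross.  The one delicate configuration, two horizontal edges meeting at the same
-- interval boundary, is impossible because the layer step across a boundary is inherited by the
-- descendants on either side of it.  As every edge spans at most two layers, putting layer k on
-- track k mod 5 gives a 5-track layout: if two edges have their tails on one track and their
-- heads on another, then either both join the same two layers or their layers are ordered alike.

module Submission where

open import Defs
open import Data.Empty using (⊥)
open import Data.Fin using (toℕ)
open import Data.Fin.Properties using (toℕ-fromℕ<)
open import Data.Nat using (ℕ; zero; suc; _+_; _*_; _^_; _≤_; _<_; _∸_; ∣_-_∣; ⌊_/2⌋; ⌈_/2⌉; NonZero; z≤n; s≤s)
open import Data.Nat.DivMod using (_%_; _/_; _mod_; m≡m%n+[m/n]*n; m%n<n; m/n≡1+[m∸n]/n; n/1≡n; m/n/o≡m/[n*o]; m<n*o⇒m/o<n; m*n/n≡m; /-monoˡ-≤; /-congʳ)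
open import Data.Nat.Properties
open import Algebra.Properties.CommutativeSemigroup +-commutativeSemigroup using (xy∙z≈xz∙y)
open import Data.Nat.Tactic.RingSolver using (solve-∀)
open import Data.Product using (_×_; _,_; proj₁; proj₂; ∃-syntax)
open import Data.Sum using (_⊎_; inj₁; inj₂; swap)
open import Relation.Binary.Definitions using (tri<; tri≈; tri>)
open import Relation.Binary.PropositionalEquality
open import Relation.Nullary using (contradiction)

2*n≡n+n : ∀ n → 2 * n ≡ n + n
2*n≡n+n n = cong (n +_) (+-identityʳ n)

m+m≡n+n⇒m≡n : ∀ {m n} → m + m ≡ n + n → m ≡ n
m+m≡n+n⇒m≡n {m} {n} eq = trans (n≡⌊n+n/2⌋ m) (trans (cong ⌊_/2⌋ eq) (sym (n≡⌊n+n/2⌋ n)))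

m+m<2*n⇒m<n : ∀ m n → m + m < 2 * n → m < n
m+m<2*n⇒m<n m n lt = *-cancelˡ-< 2 m n (subst (_< 2 * n) (sym (2*n≡n+n m)) lt)

m*[n*2^1]≡2*m*n : ∀ m n → m * (n * 2 ^ 1) ≡ 2 * m * n
m*[n*2^1]≡2*m*n = solve-∀

∣m+o-n+o∣≡∣m-n∣ : ∀ m n o → ∣ m + o - n + o ∣ ≡ ∣ m - n ∣
∣m+o-n+o∣≡∣m-n∣ m n o = trans (cong₂ ∣_-_∣ (+-comm m o) (+-comm n o)) (∣m+n-m+o∣≡∣n-o∣ o m n)

m≤n⇒∃[o]n≡o+m : ∀ {m n} → m ≤ n → ∃[ o ] n ≡ o + m
m≤n⇒∃[o]n≡o+m {m} m≤n with m≤n⇒∃[o]m+o≡n m≤n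
... | o , refl = o , +-comm m o

⌊n/2⌋≡n/2 : ∀ n → ⌊ n /2⌋ ≡ n / 2
⌊n/2⌋≡n/2 zero          = refl
⌊n/2⌋≡n/2 (suc zero)    = refl
⌊n/2⌋≡n/2 (suc (suc n)) = trans (cong suc (⌊n/2⌋≡n/2 n)) (sym (m/n≡1+[m∸n]/n {suc (suc n)} {2} (s≤s (s≤s z≤n))))

quotient-unique : ∀ {m n q} .{{_ : NonZero n}} → q * n ≤ m → m < suc q * n → m / n ≡ q
quotient-unique {m} {n} {q} lower upper = ≤-antisym (m<1+n⇒m≤n (m<n*o⇒m/o<n upper))
  (subst (_≤ m / n) (m*n/n≡m q n) (/-monoˡ-≤ n lower))

%-≡∧<⇒+-≤ : ∀ {a c} t .{{_ : NonZero t}} → a % t ≡ c % t → a < c → a + t ≤ c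
%-≡∧<⇒+-≤ {a} {c} t eq a<c = begin
  a + t                   ≡⟨ cong (_+ t) (m≡m%n+[m/n]*n a t) ⟩
  a % t + a / t * t + t   ≡⟨ +-assoc (a % t) _ t ⟩
  a % t + (a / t * t + t) ≡⟨ cong (a % t +_) (+-comm (a / t * t) t) ⟩
  a % t + suc (a / t) * t ≤⟨ +-mono-≤ (≤-reflexive eq) (*-monoˡ-≤ t quotients-<) ⟩
  c % t + c / t * t       ≡⟨ m≡m%n+[m/n]*n c t ⟨
  c                       ∎
  where
  open ≤-Reasoning
  quotients-< : a / t < c / t
  quotients-< = *-cancelʳ-< t (a / t) (c / t) (+-cancelˡ-< (c % t) _ _
    (subst₂ _<_ (trans (m≡m%n+[m/n]*n a t) (cong (_+ a / t * t) eq)) (m≡m%n+[m/n]*n c t) a<c))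

mod-≡⇒%-≡ : ∀ {a c} t .{{_ : NonZero t}} → a mod t ≡ c mod t → a % t ≡ c % t
mod-≡⇒%-≡ {a} {c} t eq = begin
  a % t          ≡⟨ toℕ-fromℕ< (m%n<n a t) ⟨
  toℕ (a mod t)  ≡⟨ cong toℕ eq ⟩
  toℕ (c mod t)  ≡⟨ toℕ-fromℕ< (m%n<n c t) ⟩
  c % t          ∎
  where open ≡-Reasoning

module Lexicographic (w : ℕ) where

  lex : ℕ → ℕ → ℕ
  lex a p = a * w + p

  lex-<ˡ : ∀ {a c p} q → a < c → p < w → lex a p < lex c q
  lex-<ˡ {a} {c} {p} q a<c p<w = begin-strict
    a * w + p   <⟨ +-monoʳ-< (a * w) p<w ⟩
    a * w + w   ≡⟨ +-comm (a * w) w ⟩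
    suc a * w   ≤⟨ *-monoˡ-≤ w a<c ⟩
    c * w       ≤⟨ m≤m+n (c * w) q ⟩
    c * w + q   ∎
    where open ≤-Reasoning

  lex-<⁻¹ : ∀ {a c p q} → p < w → q < w → lex a p < lex c q → a < c ⊎ (a ≡ c × p < q)
  lex-<⁻¹ {a} {c} {p} {q} p<w q<w lt with <-cmp a c
  ... | tri< a<c _ _  = inj₁ a<c
  ... | tri≈ _ refl _ = inj₂ (refl , +-cancelˡ-< (a * w) p q lt)
  ... | tri> _ _ c<a  = contradiction lt (<-asym (lex-<ˡ p c<a q<w))

  lex-injective : ∀ {a c p q} → p < w → q < w → lex a p ≡ lex c q → a ≡ c × p ≡ q
  lex-injective {a} {c} {p} {q} p<w q<w eq with <-cmp a c
  ... | tri< a<c _ _  = contradiction eq (<⇒≢ (lex-<ˡ q a<c p<w))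
  ... | tri≈ _ refl _ = refl , +-cancelˡ-≡ (a * w) p q eq
  ... | tri> _ _ c<a  = contradiction (sym eq) (<⇒≢ (lex-<ˡ p c<a q<w))

record LayeredDrawing (G : Graph) (s : ℕ) : Set where
  open Graph G
  field
    layer pos           : V → ℕ
    width               : ℕ
    pos<width           : ∀ u → pos u < width
    layer-≢             : ∀ {u v} → Adj u v → layer u ≢ layer v
    layer-span          : ∀ {u v} → Adj u v → ∣ layer u - layer v ∣ ≤ s
    layer-pos-injective : ∀ u v → layer u ≡ layer v → pos u ≡ pos v → u ≡ v
    uncrossed           : ∀ u v x y → Adj u v → Adj x y → layer u ≡ layer x → layer v ≡ layer y →
                          pos u < pos x → pos y < pos v → ⊥

layeredDrawing⇒trackLayout : ∀ {G s} t .{{_ : NonZero t}} → 2 * s < t →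
                             LayeredDrawing G s → TrackLayout G t
layeredDrawing⇒trackLayout {G} {s} t 2s<t D = record
  { track    = track
  ; rank     = rank
  ; indep    = indep
  ; rank-inj = λ u v _ eq →
      let (same-layer , same-pos) = lex-injective (pos<width u) (pos<width v) eq
      in layer-pos-injective u v same-layer same-pos
  ; noX      = noX
  }
  where
  open Graph G renaming (sym to adj-sym)
  open LayeredDrawing D
  open Lexicographic width

  track : V → _
  track u = layer u mod t

  rank : V → ℕ
  rank u = lex (layer u) (pos u)

  same-track-gap : ∀ {u v} → track u ≡ track v → layer u < layer v → layer u + t ≤ layer v
  same-track-gap eq = %-≡∧<⇒+-≤ t (mod-≡⇒%-≡ t eq)

  layer-≤+s : ∀ {u v} → Adj u v → layer v ≤ layer u + s
  layer-≤+s {u} {v} uv = ≤-trans (m≤n+∣m-n∣ (layer v) (layer u))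
    (+-monoʳ-≤ (layer u) (subst (_≤ s) (∣-∣-comm (layer u) (layer v)) (layer-span uv)))

  s<t : s < t
  s<t = ≤-<-trans (m≤m+n s (s + 0)) 2s<t

  heads-ordered : ∀ {u v x y} → Adj u v → Adj x y → track u ≡ track x →
                  layer u < layer x → layer v < layer y
  heads-ordered {u} {v} {x} {y} uv xy ux u<x = +-cancelʳ-< s (layer v) (layer y) (begin-strict
    layer v + s                     ≤⟨ +-monoˡ-≤ s (layer-≤+s uv) ⟩
    layer u + s + s                 ≡⟨ +-assoc (layer u) s s ⟩
    layer u + (s + s)               ≡⟨ cong (layer u +_) (2*n≡n+n s) ⟨
    layer u + 2 * s                 <⟨ +-monoʳ-< (layer u) 2s<t ⟩
    layer u + t                     ≤⟨ same-track-gap ux u<x ⟩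
    layer x                         ≤⟨ m≤n+∣m-n∣ (layer x) (layer y) ⟩
    layer y + ∣ layer x - layer y ∣ ≤⟨ +-monoʳ-≤ (layer y) (layer-span xy) ⟩
    layer y + s                     ∎)
    where open ≤-Reasoning

  indep : ∀ u v → Adj u v → track u ≢ track v
  indep u v uv eq with <-cmp (layer u) (layer v)
  ... | tri≈ _ same _ = layer-≢ uv same
  ... | tri< u<v _ _  = <⇒≱ s<t (+-cancelˡ-≤ (layer u) t s (≤-trans (same-track-gap eq u<v) (layer-≤+s uv)))
  ... | tri> _ _ v<u  = <⇒≱ s<t (+-cancelˡ-≤ (layer v) t s
                          (≤-trans (same-track-gap (sym eq) v<u) (layer-≤+s (adj-sym uv))))

  noX : ∀ u v x y → Adj u v → Adj x y → track u ≡ track x → track v ≡ track y →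
        track u ≢ track v → rank u < rank x → rank y < rank v → ⊥
  noX u v x y uv xy ux vy _ ux< yv< with lex-<⁻¹ (pos<width u) (pos<width x) ux<
                                      | lex-<⁻¹ (pos<width y) (pos<width v) yv<
  ... | inj₁ u<x             | _                     =
    <-asym yv< (lex-<ˡ (pos y) (heads-ordered uv xy ux u<x) (pos<width v))
  ... | inj₂ (u≡x , _)       | inj₁ y<v              =
    <⇒≢ (heads-ordered (adj-sym xy) (adj-sym uv) (sym vy) y<v) (sym u≡x)
  ... | inj₂ (u≡x , pu<px)   | inj₂ (y≡v , py<pv)    = uncrossed u v x y uv xy u≡x (sym y≡v) pu<px py<pv

data Halving : ℕ → Set where
  even : ∀ j → Halving (j + j)
  odd  : ∀ j → Halving (suc (j + j))

halving : ∀ n → Halving n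
halving zero = even 0
halving (suc n) with halving n
... | even j = odd j
... | odd j  = subst Halving (cong suc (+-suc j j)) (even (suc j))

lsb : ℕ → ℕ
lsb zero          = 0
lsb (suc zero)    = 1
lsb (suc (suc n)) = lsb n

lsb≤1 : ∀ n → lsb n ≤ 1
lsb≤1 zero          = z≤n
lsb≤1 (suc zero)    = s≤s z≤n
lsb≤1 (suc (suc n)) = lsb≤1 n

∣lsb-lsb∘suc∣≡1 : ∀ n → ∣ lsb n - lsb (suc n) ∣ ≡ 1
∣lsb-lsb∘suc∣≡1 zero          = refl
∣lsb-lsb∘suc∣≡1 (suc zero)    = refl
∣lsb-lsb∘suc∣≡1 (suc (suc n)) = ∣lsb-lsb∘suc∣≡1 n

-- Siblings 2j and 2j+1 get different offsets, while the neighbouring children 2j+1 and 2j+2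
-- of consecutive parents get the same one.
offset : ℕ → ℕ
offset c = lsb ⌈ c /2⌉

τ : ℕ → ℕ → ℕ
τ zero    _ = 0
τ (suc l) c = τ l ⌊ c /2⌋ + suc (offset c)

τ-even : ∀ l j → τ (suc l) (j + j) ≡ τ l j + suc (lsb j)
τ-even l j = cong₂ (λ p h → τ l p + suc (lsb h)) (sym (n≡⌊n+n/2⌋ j)) (sym (n≡⌈n+n/2⌉ j))

τ-odd : ∀ l j → τ (suc l) (suc (j + j)) ≡ τ l j + suc (lsb (suc j))
τ-odd l j = cong₂ (λ p h → τ l p + suc (lsb h)) (sym (n≡⌈n+n/2⌉ j)) (cong suc (sym (n≡⌊n+n/2⌋ j)))

τ-even-suc : ∀ l j → τ (suc l) (suc (suc (j + j))) ≡ τ l (suc j) + suc (lsb (suc j))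
τ-even-suc l j = trans (cong (τ (suc l)) (cong suc (sym (+-suc j j)))) (τ-even l (suc j))

τ-horizontal : ∀ l i → suc i < 2 ^ l → ∣ τ l i - τ l (suc i) ∣ ≡ 1
τ-horizontal zero i (s≤s ())
τ-horizontal (suc l) i i+1<2^l with halving i
... | even j rewrite τ-even l j | τ-odd l j =
  trans (∣m+n-m+o∣≡∣n-o∣ (τ l j) _ _) (∣lsb-lsb∘suc∣≡1 j)
... | odd j rewrite τ-odd l j | τ-even-suc l j = begin
  ∣ τ l j + suc (lsb (suc j)) - τ l (suc j) + suc (lsb (suc j)) ∣ ≡⟨ ∣m+o-n+o∣≡∣m-n∣ (τ l j) _ _ ⟩
  ∣ τ l j - τ l (suc j) ∣                                            ≡⟨ τ-horizontal l j j+1<2^l ⟩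
  1                                                                 ∎
  where
  open ≡-Reasoning
  j+1<2^l : suc j < 2 ^ l
  j+1<2^l = m+m<2*n⇒m<n (suc j) (2 ^ l) (subst (_< 2 ^ suc l) (cong suc (sym (+-suc j j))) i+1<2^l)

IsChild : ℕ → ℕ → Set
IsChild c i = c ≡ 2 * i ⊎ c ≡ 2 * i + 1

parent-index : ∀ {c} i → IsChild c i → ⌊ c /2⌋ ≡ i
parent-index i (inj₁ refl) = trans (cong ⌊_/2⌋ (2*n≡n+n i)) (sym (n≡⌊n+n/2⌋ i))
parent-index i (inj₂ refl) = trans (cong ⌊_/2⌋ (trans (+-comm (2 * i) 1) (cong suc (2*n≡n+n i))))
                                   (sym (n≡⌈n+n/2⌉ i))

xedge-span : ∀ {l i l′ j} → j < 2 ^ l′ → XEdge (l , i) (l′ , j) →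
             0 < ∣ τ l i - τ l′ j ∣ × ∣ τ l i - τ l′ j ∣ ≤ 2
xedge-span {l} {i} {j = j} _ (inj₁ (refl , child))
  rewrite parent-index i child | ∣m-m+n∣≡n (τ l i) (suc (offset j)) = s≤s z≤n , s≤s (lsb≤1 ⌈ j /2⌉)
xedge-span {l} {i} i+1<2^l (inj₂ (refl , refl)) rewrite τ-horizontal l i i+1<2^l = s≤s z≤n , s≤s z≤n

ancestor : ℕ → ℕ → ℕ
ancestor m j = _/_ j (2 ^ m) {{m^n≢0 2 m}}

τ-ancestor : ∀ m l j → τ l (ancestor m j) + m ≤ τ (m + l) j
τ-ancestor zero l j = ≤-reflexive (trans (+-identityʳ _) (cong (τ l) (n/1≡n j)))
τ-ancestor (suc m) l j = begin
  τ l (ancestor (suc m) j) + suc m   ≡⟨ +-suc _ m ⟩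
  suc (τ l (ancestor (suc m) j) + m) ≡⟨ cong (λ a → suc (τ l a + m)) halve-first ⟩
  suc (τ l (ancestor m ⌊ j /2⌋) + m) ≤⟨ s≤s (τ-ancestor m l ⌊ j /2⌋) ⟩
  suc (τ (m + l) ⌊ j /2⌋)            ≡⟨ +-comm 1 _ ⟩
  τ (m + l) ⌊ j /2⌋ + 1              ≤⟨ +-monoʳ-≤ (τ (m + l) ⌊ j /2⌋) (s≤s z≤n) ⟩
  τ (suc m + l) j                    ∎
  where
  open ≤-Reasoning
  instance
    2^m≢0 : NonZero (2 ^ m)
    2^m≢0 = m^n≢0 2 m
    2^1+m≢0 : NonZero (2 ^ suc m)
    2^1+m≢0 = m^n≢0 2 (suc m)
  halve-first : ancestor (suc m) j ≡ ancestor m ⌊ j /2⌋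
  halve-first = trans (sym (m/n/o≡m/[n*o] j 2 (2 ^ m))) (cong (_/ 2 ^ m) (sym (⌊n/2⌋≡n/2 j)))

τ-ancestor-≡ : ∀ m l j → τ l (ancestor m j) ≡ τ (m + l) j → m ≡ 0
τ-ancestor-≡ m l j eq = n≤0⇒n≡0 (+-cancelˡ-≤ (τ l (ancestor m j)) m 0
  (≤-trans (τ-ancestor m l j) (≤-reflexive (trans (sym eq) (sym (+-identityʳ _))))))

-- k′ and suc k′ are the descendants, m levels down, on either side of the boundary between k
-- and suc k, and the layer step across the boundary is the same at both depths.
τ-boundary : ∀ m l k → ∃[ k′ ] suc k′ ≡ suc k * 2 ^ m ×
             τ (m + l) (suc k′) + τ l k ≡ τ (m + l) k′ + τ l (suc k)
τ-boundary zero l k = k , sym (*-identityʳ (suc k)) , +-comm (τ l (suc k)) (τ l k)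
τ-boundary (suc m) l k with τ-boundary m l k
... | k′ , k′+1≡ , eq = suc (k′ + k′) , twice , (begin
  τ (suc m + l) (suc (suc (k′ + k′))) + τ l k  ≡⟨ cong (_+ τ l k) (τ-even-suc (m + l) k′) ⟩
  τ (m + l) (suc k′) + o + τ l k               ≡⟨ xy∙z≈xz∙y (τ (m + l) (suc k′)) o (τ l k) ⟩
  τ (m + l) (suc k′) + τ l k + o               ≡⟨ cong (_+ o) eq ⟩
  τ (m + l) k′ + τ l (suc k) + o               ≡⟨ xy∙z≈xz∙y (τ (m + l) k′) o (τ l (suc k)) ⟨
  τ (m + l) k′ + o + τ l (suc k)               ≡⟨ cong (_+ τ l (suc k)) (τ-odd (m + l) k′) ⟨
  τ (suc m + l) (suc (k′ + k′)) + τ l (suc k)  ∎)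
  where
  open ≡-Reasoning
  o = suc (lsb (suc k′))
  twice : suc (suc (k′ + k′)) ≡ suc k * 2 ^ suc m
  twice = begin
    suc (suc (k′ + k′))                 ≡⟨ cong suc (+-suc k′ k′) ⟨
    suc k′ + suc k′                     ≡⟨ cong₂ _+_ k′+1≡ (trans k′+1≡ (cong (suc k *_) (sym (+-identityʳ _)))) ⟩
    suc k * 2 ^ m + suc k * (2 ^ m + 0) ≡⟨ *-distribˡ-+ (suc k) (2 ^ m) (2 ^ m + 0) ⟨
    suc k * 2 ^ suc m                   ∎

module XTreeGeometry (d : ℕ) where

  -- The vertex at depth l and position i covers the leaves pos = i · block l ≤ p < end.
  block : ℕ → ℕ
  block l = 2 ^ (d ∸ l)

  V : Set
  V = XVertex d

  depth index layer pos end : V → ℕ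
  depth u = proj₁ (proj₁ u)
  index u = proj₂ (proj₁ u)
  layer u = τ (depth u) (index u)
  pos   u = index u * block (depth u)
  end   u = suc (index u) * block (depth u)

  Contains : V → ℕ → Set
  Contains u p = pos u ≤ p × p < end u

  RightNeighbour : V → V → Set
  RightNeighbour u v = depth v ≡ depth u × index v ≡ suc (index u)

  vertex-≡ : ∀ {u v} → depth u ≡ depth v → index u ≡ index v → u ≡ v
  vertex-≡ {(l , i) , l≤d , i<2^l} {(.l , .i) , l≤d′ , i<2^l′} refl refl =
    cong₂ (λ p q → (l , i) , p , q) (≤-irrelevant l≤d l≤d′) (<-irrelevant i<2^l i<2^l′)

  pos<end : ∀ u → pos u < end u
  pos<end u = m<n+m (pos u) (m^n>0 2 (d ∸ depth u))

  end≤2^d : ∀ u → end u ≤ 2 ^ d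
  end≤2^d ((l , i) , l≤d , i<2^l) = begin
    suc i * block l     ≤⟨ *-monoˡ-≤ (block l) i<2^l ⟩
    2 ^ l * block l     ≡⟨ ^-distribˡ-+-* 2 l (d ∸ l) ⟨
    2 ^ (l + (d ∸ l))   ≡⟨ cong (2 ^_) (m+[n∸m]≡n l≤d) ⟩
    2 ^ d               ∎
    where open ≤-Reasoning

  block-split : ∀ m l → m + l ≤ d → block l ≡ block (m + l) * 2 ^ m
  block-split m l le = begin
    2 ^ (d ∸ l)                   ≡⟨ cong (2 ^_) (m∸n+n≡m (m+n≤o⇒m≤o∸n m le)) ⟨
    2 ^ (d ∸ l ∸ m + m)           ≡⟨ ^-distribˡ-+-* 2 (d ∸ l ∸ m) m ⟩
    2 ^ (d ∸ l ∸ m) * 2 ^ m       ≡⟨ cong (λ e → 2 ^ e * 2 ^ m) (trans (∸-+-assoc d l m) (cong (d ∸_) (+-comm l m))) ⟩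
    block (m + l) * 2 ^ m         ∎
    where open ≡-Reasoning

  common-point⇒ancestor : ∀ u x {p m} → depth x ≡ m + depth u → Contains u p → Contains x p →
                          index u ≡ ancestor m (index x)
  common-point⇒ancestor ((l , i) , _) ((.(m + l) , j) , m+l≤d , _) {p} {m} refl p∈u p∈x = begin
    i                           ≡⟨ quotient-unique (proj₁ p∈u) (proj₂ p∈u) ⟨
    p / block l                 ≡⟨ /-congʳ (block-split m l m+l≤d) ⟩
    p / (block (m + l) * 2 ^ m) ≡⟨ m/n/o≡m/[n*o] p (block (m + l)) (2 ^ m) ⟨
    p / block (m + l) / 2 ^ m   ≡⟨ cong (_/ 2 ^ m) (quotient-unique (proj₁ p∈x) (proj₂ p∈x)) ⟩
    j / 2 ^ m                   ∎
    where
    open ≡-Reasoning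
    instance
      2^m≢0 : NonZero (2 ^ m)
      2^m≢0 = m^n≢0 2 m
      block-l≢0 : NonZero (block l)
      block-l≢0 = m^n≢0 2 (d ∸ l)
      block-m+l≢0 : NonZero (block (m + l))
      block-m+l≢0 = m^n≢0 2 (d ∸ (m + l))
      product≢0 : NonZero (block (m + l) * 2 ^ m)
      product≢0 = m*n≢0 (block (m + l)) (2 ^ m)

  shallower-common-point⇒≡ : ∀ u x {p} → depth u ≤ depth x → Contains u p → Contains x p →
                             layer u ≡ layer x → u ≡ x
  shallower-common-point⇒≡ u x u≤x p∈u p∈x same-layer with m≤n⇒∃[o]n≡o+m u≤x
  ... | m , depth-x with common-point⇒ancestor u x depth-x p∈u p∈x
  ... | index-u with τ-ancestor-≡ m (depth u) (index x)
                       (trans (cong (τ (depth u)) (sym index-u))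
                              (trans same-layer (cong (λ l → τ l (index x)) depth-x)))
  ... | refl = vertex-≡ (sym depth-x) (trans index-u (n/1≡n (index x)))

  common-point⇒≡ : ∀ u x {p} → Contains u p → Contains x p → layer u ≡ layer x → u ≡ x
  common-point⇒≡ u x p∈u p∈x same-layer with ≤-total (depth u) (depth x)
  ... | inj₁ u≤x = shallower-common-point⇒≡ u x u≤x p∈u p∈x same-layer
  ... | inj₂ x≤u = sym (shallower-common-point⇒≡ x u x≤u p∈x p∈u (sym same-layer))

  same-layer-disjoint : ∀ u x → layer u ≡ layer x → pos u < pos x → end u ≤ pos x
  same-layer-disjoint u x same-layer pu<px = ≮⇒≥ λ px<eu →
    <-irrefl (cong pos (common-point⇒≡ u x (<⇒≤ pu<px , px<eu) (≤-refl , pos<end x) same-layer)) pu<px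

  same-layer-pos-injective : ∀ u x → layer u ≡ layer x → pos u ≡ pos x → u ≡ x
  same-layer-pos-injective u x same-layer same-pos = common-point⇒≡ u x (≤-refl , pos<end u)
    (≤-reflexive (sym same-pos) , subst (_< end x) (sym same-pos) (pos<end x)) same-layer

  child-within : ∀ {l c} i → suc l ≤ d → IsChild c i →
                 i * block l ≤ c * block (suc l) × suc c * block (suc l) ≤ suc i * block l
  child-within {l} {c} i l<d child = lower child , upper child
    where
    B = block (suc l)
    in-halves : ∀ n → n * block l ≡ 2 * n * B
    in-halves n = trans (cong (n *_) (block-split 1 l l<d)) (m*[n*2^1]≡2*m*n n B)
    lower : IsChild c i → i * block l ≤ c * B
    lower (inj₁ refl) = ≤-reflexive (in-halves i)
    lower (inj₂ refl) = ≤-trans (≤-reflexive (in-halves i)) (*-monoˡ-≤ B (m≤m+n (2 * i) 1))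
    upper : IsChild c i → suc c * B ≤ suc i * block l
    upper c-child = subst (suc c * B ≤_) (sym (in-halves (suc i))) (*-monoˡ-≤ B (index-bound c-child))
      where
      index-bound : IsChild c i → suc c ≤ 2 * suc i
      index-bound (inj₁ refl) = ≤-trans (n≤1+n _) (≤-reflexive (sym (*-suc 2 i)))
      index-bound (inj₂ refl) = ≤-reflexive (trans (cong suc (+-comm (2 * i) 1)) (sym (*-suc 2 i)))

  adj-geometry : ∀ u v → XAdj u v → pos v < end u ⊎ RightNeighbour u v
  adj-geometry ((l , i) , _) v@((.(suc l) , c) , l<d , _) (inj₁ (inj₁ (refl , child))) =
    inj₁ (<-≤-trans (pos<end v) (proj₂ (child-within i l<d child)))
  adj-geometry _ _ (inj₁ (inj₂ (refl , refl))) = inj₂ (refl , refl)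
  adj-geometry u@((.(suc l) , c) , l<d , _) ((l , i) , _) (inj₂ (inj₁ (refl , child))) =
    inj₁ (≤-<-trans (proj₁ (child-within i l<d child)) (pos<end u))
  adj-geometry u@((l , .(suc i)) , _) v@((.l , i) , _) (inj₂ (inj₂ (refl , refl))) =
    inj₁ (<-trans (pos<end v) (pos<end u))

  pos≤end : ∀ u v → pos v < end u ⊎ RightNeighbour u v → pos v ≤ end u
  pos≤end u v (inj₁ pv<eu) = <⇒≤ pv<eu
  pos≤end u v (inj₂ (refl , refl)) = ≤-refl

  shallower-neighbour-swap : ∀ u v y x → depth u ≤ depth y → RightNeighbour u v → RightNeighbour y x →
                             end u ≡ end y → layer u ≡ layer x → layer v ≡ layer y → ⊥
  shallower-neighbour-swap ((l , k) , l≤d , _) ((.l , .(suc k)) , _ , k+1<2^l)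
                           ((ly , k′) , ly≤d , _) ((.ly , .(suc k′)) , _)
                           u≤y (refl , refl) (refl , refl) ends ux vy with m≤n⇒∃[o]n≡o+m u≤y
  ... | m , refl with τ-boundary m l k
  ... | k″ , k″+1≡ , inherited = 1+n≢0 (begin
        1                        ≡⟨ τ-horizontal l k k+1<2^l ⟨
        ∣ τ l k - τ l (suc k) ∣  ≡⟨ cong (λ t → ∣ τ l k - t ∣) swapped-equal ⟨
        ∣ τ l k - τ l k ∣        ≡⟨ ∣n-n∣≡0 (τ l k) ⟩
        0                        ∎)
    where
    open ≡-Reasoning
    instance
      block≢0 : NonZero (block (m + l))
      block≢0 = m^n≢0 2 (d ∸ (m + l))
    scale : suc k * 2 ^ m ≡ suc k′
    scale = *-cancelʳ-≡ (suc k * 2 ^ m) (suc k′) (block (m + l)) (begin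
      suc k * 2 ^ m * block (m + l)   ≡⟨ *-assoc (suc k) (2 ^ m) _ ⟩
      suc k * (2 ^ m * block (m + l)) ≡⟨ cong (suc k *_) (*-comm (2 ^ m) _) ⟩
      suc k * (block (m + l) * 2 ^ m) ≡⟨ cong (suc k *_) (block-split m l ly≤d) ⟨
      suc k * block l                 ≡⟨ ends ⟩
      suc k′ * block (m + l)          ∎)
    k″≡k′ : k″ ≡ k′
    k″≡k′ = suc-injective (trans k″+1≡ scale)
    swapped-equal : τ l k ≡ τ l (suc k)
    swapped-equal = m+m≡n+n⇒m≡n (begin
      τ l k + τ l k                    ≡⟨ cong (_+ τ l k) ux ⟩
      τ (m + l) (suc k′) + τ l k       ≡⟨ subst (λ z → τ (m + l) (suc z) + τ l k ≡ τ (m + l) z + τ l (suc k)) k″≡k′ inherited ⟩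
      τ (m + l) k′ + τ l (suc k)       ≡⟨ cong (_+ τ l (suc k)) vy ⟨
      τ l (suc k) + τ l (suc k)        ∎)

  no-neighbour-swap : ∀ u v y x → RightNeighbour u v → RightNeighbour y x →
                      end u ≡ end y → layer u ≡ layer x → layer v ≡ layer y → ⊥
  no-neighbour-swap u v y x uv yx ends ux vy with ≤-total (depth u) (depth y)
  ... | inj₁ u≤y = shallower-neighbour-swap u v y x u≤y uv yx ends ux vy
  ... | inj₂ y≤u = shallower-neighbour-swap y x u v y≤u yx uv (sym ends) (sym vy) (sym ux)

  uncrossed : ∀ u v x y → XAdj u v → XAdj x y → layer u ≡ layer x → layer v ≡ layer y →
              pos u < pos x → pos y < pos v → ⊥
  uncrossed u v x y uv xy ux vy pu<px py<pv = by-geometry (adj-geometry u v uv) (adj-geometry y x (swap xy))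
    where
    open ≤-Reasoning
    eu≤px : end u ≤ pos x
    eu≤px = same-layer-disjoint u x ux pu<px
    ey≤pv : end y ≤ pos v
    ey≤pv = same-layer-disjoint y v (sym vy) py<pv
    by-geometry : pos v < end u ⊎ RightNeighbour u v → pos x < end y ⊎ RightNeighbour y x → ⊥
    by-geometry (inj₁ pv<eu) yx = <-irrefl refl (begin-strict
      end u  ≤⟨ eu≤px ⟩
      pos x  ≤⟨ pos≤end y x yx ⟩
      end y  ≤⟨ ey≤pv ⟩
      pos v  <⟨ pv<eu ⟩
      end u  ∎)
    by-geometry uv′ (inj₁ px<ey) = <-irrefl refl (begin-strict
      end y  ≤⟨ ey≤pv ⟩
      pos v  ≤⟨ pos≤end u v uv′ ⟩
      end u  ≤⟨ eu≤px ⟩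
      pos x  <⟨ px<ey ⟩
      end y  ∎)
    by-geometry (inj₂ v-right) (inj₂ x-right) = no-neighbour-swap u v y x v-right x-right
      (≤-antisym (≤-trans eu≤px (pos≤end y x (inj₂ x-right))) (≤-trans ey≤pv (pos≤end u v (inj₂ v-right)))) ux vy

  adj-span : ∀ u v → XAdj u v → 0 < ∣ layer u - layer v ∣ × ∣ layer u - layer v ∣ ≤ 2
  adj-span _ (_ , _ , j<2^l′) (inj₁ e) = xedge-span j<2^l′ e
  adj-span u@(_ , _ , i<2^l) v (inj₂ e) =
    subst (λ n → 0 < n × n ≤ 2) (∣-∣-comm (layer v) (layer u)) (xedge-span i<2^l e)

xTreeDrawing : ∀ d → LayeredDrawing (XTree d) 2
xTreeDrawing d = record
  { layer               = layer
  ; pos                 = pos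
  ; width               = 2 ^ d
  ; pos<width           = λ u → <-≤-trans (pos<end u) (end≤2^d u)
  ; layer-≢             = λ {u} {v} uv same → <⇒≢ (proj₁ (adj-span u v uv)) (sym (m≡n⇒∣m-n∣≡0 same))
  ; layer-span          = λ {u} {v} uv → proj₂ (adj-span u v uv)
  ; layer-pos-injective = same-layer-pos-injective
  ; uncrossed           = uncrossed
  }
  where open XTreeGeometry d

theorem4 : (d : ℕ) → TrackLayout (XTree d) 5
theorem4 d = layeredDrawing⇒trackLayout 5 ≤-refl (xTreeDrawing d)
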